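{- Let $G_0$ be a stepwise irregular graph having a vertex $u$ of degree $2$ both of whose neighbours have degree $3$. Let $G_1$ be obtained from $G_0$ by adding seven new vertices $a,b,c,d,e,f,g$ and the eight new edges $ua,\ ab,\ bc,\ ad,\ de,\ ue,\ ef,\ fg$. Then $G_1$ is stepwise irregular. Moreover, if $G_0$ has cyclomatic number $\gamma$, then $G_1$ has cyclomatic number $\gamma+1$.
   Context: All graphs are finite and simple. A graph $G$ is stepwise irregular (SI) if for every edge $uv\in E(G)$ one has $|d_G(u)-d_G(v)|=1$, where $d_G$ denotes degree. The cyclomatic number of a connected graph with $n$ vertices and $m$ edges is $\gamma=m-n+1$. -}

module Defs where

open import Data.Nat using (ℕ; zero; suc; _+_; _<ᵇ_)
open import Data.Integer using (ℤ; +_; _-_)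
import Data.Integer as ℤ
open import Data.Bool using (Bool; true; false; _∧_; _∨_; if_then_else_)
open import Data.Bool.Properties using (∨-comm)
open import Data.Fin using (Fin; toℕ; splitAt; _≟_)
open import Data.List using (map; allFin)
open import Data.Nat.ListAction using (sum)
open import Data.Sum using (_⊎_; inj₁; inj₂)
open import Relation.Nullary.Decidable using (⌊_⌋)
open import Relation.Binary.PropositionalEquality using (_≡_; refl)

record Graph (n : ℕ) : Set where
  field
    adj    : Fin n → Fin n → Bool
    sym    : ∀ i j → adj i j ≡ adj j i
    irrefl : ∀ i → adj i i ≡ false
open Graph public

degree : ∀ {n} → Graph n → Fin n → ℕ
degree {n} G v = sum (map (λ w → if adj G v w then 1 else 0) (allFin n))

numEdges : ∀ {n} → Graph n → ℕ
numEdges {n} G =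
  sum (map (λ i → sum (map (λ j → if (toℕ i <ᵇ toℕ j) ∧ adj G i j then 1 else 0)
                            (allFin n)))
           (allFin n))

StepwiseIrregular : ∀ {n} → Graph n → Set
StepwiseIrregular G =
  ∀ u v → adj G u v ≡ true →
    (degree G u ≡ suc (degree G v)) ⊎ (degree G v ≡ suc (degree G u))

data Reach {n : ℕ} (G : Graph n) : Fin n → Fin n → Set where
  here : ∀ {i} → Reach G i i
  step : ∀ {i j k} → adj G i j ≡ true → Reach G j k → Reach G i k

Connected : ∀ {n} → Graph n → Set
Connected {n} G = ∀ (i j : Fin n) → Reach G i j

-- cyclomatic number m - n + 1 (meaningful for connected graphs)
cyclomatic : ∀ {n} → Graph n → ℤ
cyclomatic {n} G = (+ numEdges G) - (+ n) ℤ.+ (+ 1)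

-- New vertices are Fin 7 with labels  0=a 1=b 2=c 3=d 4=e 5=f 6=g,
-- placed after the old ones: vertex set Fin (n + 7), split by splitAt n.

newEdgeℕ : ℕ → ℕ → Bool
newEdgeℕ 0 1 = true
newEdgeℕ 1 2 = true
newEdgeℕ 0 3 = true
newEdgeℕ 3 4 = true
newEdgeℕ 4 5 = true
newEdgeℕ 5 6 = true
newEdgeℕ _ _ = false

newAdj : Fin 7 → Fin 7 → Bool
newAdj k l = newEdgeℕ (toℕ k) (toℕ l) ∨ newEdgeℕ (toℕ l) (toℕ k)

attachedToU : Fin 7 → Bool
attachedToU k with toℕ k
... | 0 = true
... | 4 = true
... | _ = false

extAdj : ∀ {n} → Graph n → Fin n → Fin n ⊎ Fin 7 → Fin n ⊎ Fin 7 → Bool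
extAdj G u (inj₁ x) (inj₁ y) = adj G x y
extAdj G u (inj₁ x) (inj₂ k) = ⌊ x ≟ u ⌋ ∧ attachedToU k
extAdj G u (inj₂ k) (inj₁ x) = ⌊ x ≟ u ⌋ ∧ attachedToU k
extAdj G u (inj₂ k) (inj₂ l) = newAdj k l

extAdj-sym : ∀ {n} (G : Graph n) u p q → extAdj G u p q ≡ extAdj G u q p
extAdj-sym G u (inj₁ x) (inj₁ y) = sym G x y
extAdj-sym G u (inj₁ x) (inj₂ k) = refl
extAdj-sym G u (inj₂ k) (inj₁ x) = refl
extAdj-sym G u (inj₂ k) (inj₂ l) = ∨-comm (newEdgeℕ (toℕ k) (toℕ l)) _

newAdj-irrefl : ∀ k → newAdj k k ≡ false
newAdj-irrefl Fin.zero = refl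
newAdj-irrefl (Fin.suc Fin.zero) = refl
newAdj-irrefl (Fin.suc (Fin.suc Fin.zero)) = refl
newAdj-irrefl (Fin.suc (Fin.suc (Fin.suc Fin.zero))) = refl
newAdj-irrefl (Fin.suc (Fin.suc (Fin.suc (Fin.suc Fin.zero)))) = refl
newAdj-irrefl (Fin.suc (Fin.suc (Fin.suc (Fin.suc (Fin.suc Fin.zero))))) = refl
newAdj-irrefl (Fin.suc (Fin.suc (Fin.suc (Fin.suc (Fin.suc (Fin.suc Fin.zero)))))) = refl

extAdj-irrefl : ∀ {n} (G : Graph n) u p → extAdj G u p p ≡ false
extAdj-irrefl G u (inj₁ x) = irrefl G x
extAdj-irrefl G u (inj₂ k) = newAdj-irrefl k

extend : ∀ {n} → Graph n → Fin n → Graph (n + 7)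
extend {n} G u = record
  { adj    = λ i j → extAdj G u (splitAt n i) (splitAt n j)
  ; sym    = λ i j → extAdj-sym G u (splitAt n i) (splitAt n j)
  ; irrefl = λ i → extAdj-irrefl G u (splitAt n i)
  }

module Submission where

-- In G₁ = extend G₀ u every degree is known explicitly: an old
-- vertex x keeps its G₀-degree, except u, which gains the two neighbours a
-- and e; the seven gadget vertices a,…,g have degrees 3,2,1,2,3,2,1.
-- Stepwise irregularity of G₁ then follows edge by edge: an edge of G₀
-- avoiding u is unchanged, an edge of G₀ at u now joins degrees 4 and 3,
-- the edges ua and ue join degrees 4 and 3, and the six gadget edges are
-- checked by a finite decision procedure.  Connectivity: every gadget
-- vertex has a walk to u, and walks of G₀ lift to G₁.  Counting: G₁ has
-- 8 more edges (ua, ue and six gadget edges) and 7 more vertices, so the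
-- cyclomatic number grows by exactly 1.

open import Defs renaming (sym to adj-sym)
open import Data.Nat using (ℕ)
open import Data.Fin using (Fin)

module FiniteSums where
  open import Data.Nat using (zero; suc; _+_)
  open import Data.Nat.Properties using (+-assoc; +-identityʳ; +-0-commutativeMonoid)
  open import Data.Fin using (zero; suc; splitAt; _↑ˡ_; _↑ʳ_; _≟_)
  open import Data.Fin.Properties using (splitAt-↑ˡ; splitAt-↑ʳ)
  open import Data.Sum using (_⊎_; inj₁; inj₂)
  open import Data.Bool using (Bool; true; false; _∧_; if_then_else_)
  open import Data.List using (map; tabulate; allFin)
  open import Data.Nat.ListAction using (sum)
  open import Relation.Nullary.Decidable using (⌊_⌋; yes; no)
  open import Relation.Binary.PropositionalEquality using (_≡_; refl; trans; cong; cong₂; sym; module ≡-Reasoning)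
  open import Algebra.Properties.CommutativeMonoid.Sum +-0-commutativeMonoid public
    using (sum-syntax; sum-cong-≗; ∑-distrib-+; sum-replicate-zero)

  ind : Bool → ℕ
  ind b = if b then 1 else 0

  ind-∧ : ∀ b c → ind (b ∧ c) ≡ (if b then ind c else 0)
  ind-∧ true  c = refl
  ind-∧ false c = refl

  listSum-tabulate : ∀ {A : Set} n (f : A → ℕ) (g : Fin n → A) →
                     sum (map f (tabulate g)) ≡ ∑[ i < n ] f (g i)
  listSum-tabulate zero    f g = refl
  listSum-tabulate (suc n) f g = cong (f (g zero) +_) (listSum-tabulate n f (λ i → g (suc i)))

  listSum-allFin : ∀ n (f : Fin n → ℕ) → sum (map f (allFin n)) ≡ ∑[ i < n ] f i
  listSum-allFin n f = listSum-tabulate n f (λ i → i)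

  ∑-++ : ∀ m n (f : Fin (m + n) → ℕ) →
         ∑[ i < m + n ] f i ≡ ∑[ i < m ] f (i ↑ˡ n) + ∑[ k < n ] f (m ↑ʳ k)
  ∑-++ zero    n f = refl
  ∑-++ (suc m) n f = begin
    f zero + ∑[ i < m + n ] f (suc i)
      ≡⟨ cong (f zero +_) (∑-++ m n (λ i → f (suc i))) ⟩
    f zero + (∑[ i < m ] f (suc (i ↑ˡ n)) + ∑[ k < n ] f (suc m ↑ʳ k))
      ≡⟨ sym (+-assoc (f zero) _ _) ⟩
    f zero + ∑[ i < m ] f (suc (i ↑ˡ n)) + ∑[ k < n ] f (suc m ↑ʳ k)  ∎
    where open ≡-Reasoning

  ∑-splitAt : ∀ m n (g : Fin m ⊎ Fin n → ℕ) →
              ∑[ i < m + n ] g (splitAt m i) ≡ ∑[ i < m ] g (inj₁ i) + ∑[ k < n ] g (inj₂ k)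
  ∑-splitAt m n g = begin
    ∑[ i < m + n ] g (splitAt m i)
      ≡⟨ ∑-++ m n (λ i → g (splitAt m i)) ⟩
    ∑[ i < m ] g (splitAt m (i ↑ˡ n)) + ∑[ k < n ] g (splitAt m (m ↑ʳ k))
      ≡⟨ cong₂ _+_ (sum-cong-≗ (λ i → cong g (splitAt-↑ˡ m i n)))
                   (sum-cong-≗ (λ k → cong g (splitAt-↑ʳ m n k))) ⟩
    ∑[ i < m ] g (inj₁ i) + ∑[ k < n ] g (inj₂ k)  ∎
    where open ≡-Reasoning

  ∑-pointMass : ∀ n (u : Fin n) a → ∑[ y < n ] (if ⌊ y ≟ u ⌋ then a else 0) ≡ a
  ∑-pointMass (suc n) zero    a = trans (cong (a +_) (sum-replicate-zero n)) (+-identityʳ a)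
  ∑-pointMass (suc n) (suc u) a =
    trans (sum-cong-≗ (λ y → cong (λ b → if b then a else 0) (≟-suc y u))) (∑-pointMass n u a)
    where
      ≟-suc : ∀ {m} (y v : Fin m) → ⌊ suc y ≟ suc v ⌋ ≡ ⌊ y ≟ v ⌋
      ≟-suc y v with y ≟ v
      ... | yes _ = refl
      ... | no  _ = refl

-- Walks: reachability is an equivalence relation, so a graph is connected
-- as soon as every vertex reaches one fixed hub.
module Walks where
  open import Data.Bool using (true)
  open import Relation.Binary.PropositionalEquality using (_≡_; trans)

  reach-snoc : ∀ {n} {H : Graph n} {i j k} → Reach H i j → adj H j k ≡ true → Reach H i k
  reach-snoc here       e′ = step e′ here
  reach-snoc (step e r) e′ = step e (reach-snoc r e′)

  reach-sym : ∀ {n} {H : Graph n} {i j} → Reach H i j → Reach H j i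
  reach-sym         here               = here
  reach-sym {H = H} (step {i} {j} e r) = reach-snoc (reach-sym r) (trans (adj-sym H j i) e)

  reach-trans : ∀ {n} {H : Graph n} {i j k} → Reach H i j → Reach H j k → Reach H i k
  reach-trans here       r′ = r′
  reach-trans (step e r) r′ = step e (reach-trans r r′)

  connected-via-hub : ∀ {n} {H : Graph n} (hub : Fin n) → (∀ p → Reach H p hub) → Connected H
  connected-via-hub hub toHub p q = reach-trans (toHub p) (reach-sym (toHub q))

module Gadget where
  open import Data.Nat using (suc; _+_)
  import Data.Nat as ℕ
  open import Data.Fin.Patterns using (0F; 4F)
  open import Data.Fin.Properties using (all?)
  open import Data.Bool using (true)
  open import Data.Bool.Properties using () renaming (_≟_ to _≟ᵇ_)
  open import Data.Sum using (_⊎_)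
  open import Data.Unit using (tt)
  open import Relation.Nullary.Decidable using (Dec; _⊎-dec_; _→-dec_; toWitness)
  open import Relation.Binary.PropositionalEquality using (_≡_; refl)
  open FiniteSums

  Stepwise : ℕ → ℕ → Set
  Stepwise a b = (a ≡ suc b) ⊎ (b ≡ suc a)

  stepwise? : ∀ a b → Dec (Stepwise a b)
  stepwise? a b = (a ℕ.≟ suc b) ⊎-dec (b ℕ.≟ suc a)

  gadgetDegree : Fin 7 → ℕ
  gadgetDegree k = ind (attachedToU k) + ∑[ l < 7 ] ind (newAdj k l)

  gadget-stepwise : ∀ k l → newAdj k l ≡ true → Stepwise (gadgetDegree k) (gadgetDegree l)
  gadget-stepwise = toWitness {a? = all? λ k → all? λ l →
    (newAdj k l ≟ᵇ true) →-dec stepwise? (gadgetDegree k) (gadgetDegree l)} tt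

  attached-degree : ∀ k → attachedToU k ≡ true → gadgetDegree k ≡ 3
  attached-degree 0F _ = refl
  attached-degree 4F _ = refl

module Edges where
  open import Data.Nat using (zero; suc; _+_; _<_; _<ᵇ_; s≤s)
  open import Data.Fin using (toℕ)
  open import Data.Bool using (true; false; _∧_)
  open import Relation.Binary.PropositionalEquality using (_≡_; refl; trans)
  open FiniteSums

  lowerEdge : ∀ {n} → Graph n → Fin n → Fin n → ℕ
  lowerEdge H p q = ind ((toℕ p <ᵇ toℕ q) ∧ adj H p q)

  numEdges-∑ : ∀ {n} (H : Graph n) → numEdges H ≡ ∑[ p < n ] ∑[ q < n ] lowerEdge H p q
  numEdges-∑ {n} H = trans (listSum-allFin n _) (sum-cong-≗ {n} (λ p → listSum-allFin n _))

  <ᵇ-first-second : ∀ a n k → a < n → (a <ᵇ n + k) ≡ true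
  <ᵇ-first-second zero    (suc n) k _       = refl
  <ᵇ-first-second (suc a) (suc n) k (s≤s p) = <ᵇ-first-second a n k p

  <ᵇ-second-first : ∀ n k a → a < n → (n + k <ᵇ a) ≡ false
  <ᵇ-second-first (suc n) k zero    _       = refl
  <ᵇ-second-first (suc n) k (suc a) (s≤s p) = <ᵇ-second-first n k a p

  <ᵇ-shift : ∀ n a b → (n + a <ᵇ n + b) ≡ (a <ᵇ b)
  <ᵇ-shift zero    a b = refl
  <ᵇ-shift (suc n) a b = <ᵇ-shift n a b

module Extension {n : ℕ} (G : Graph n) (u : Fin n) where
  open import Data.Nat using (_+_; _<ᵇ_)
  open import Data.Nat.Properties using (+-assoc; +-identityʳ)
  open import Data.Fin using (toℕ; splitAt; _↑ˡ_; _↑ʳ_; _≟_)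
  open import Data.Fin.Patterns using (0F; 1F; 2F; 3F; 4F; 5F; 6F)
  open import Data.Fin.Properties using (splitAt-↑ˡ; splitAt-↑ʳ; toℕ-↑ˡ; toℕ-↑ʳ; toℕ<n; splitAt⁻¹-↑ˡ; splitAt⁻¹-↑ʳ)
  open import Data.Bool using (true; false; _∧_; if_then_else_)
  open import Data.Sum using (_⊎_; inj₁; inj₂; swap)
  open import Relation.Nullary.Negation using (contradiction)
  import Data.Integer as ℤ
  open import Data.Integer.Properties using (pos-+)
  open import Data.Integer.Tactic.RingSolver using (solve-∀)
  open import Relation.Nullary.Decidable using (⌊_⌋; yes; no)
  open import Relation.Binary.PropositionalEquality using (_≡_; refl; sym; trans; cong; cong₂; subst; module ≡-Reasoning)
  open FiniteSums
  open Walks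
  open Gadget
  open Edges

  G₁ : Graph (n + 7)
  G₁ = extend G u

  -- The edges ua and ue give u two extra neighbours.
  bonus : Fin n → ℕ
  bonus x = if ⌊ x ≟ u ⌋ then 2 else 0

  blockDegree : Fin n ⊎ Fin 7 → ℕ
  blockDegree (inj₁ x) = degree G x + bonus x
  blockDegree (inj₂ k) = gadgetDegree k

  blockRow-degree : ∀ s → ∑[ y < n ] ind (extAdj G u s (inj₁ y)) + ∑[ k < 7 ] ind (extAdj G u s (inj₂ k))
                          ≡ blockDegree s
  blockRow-degree (inj₁ x) with x ≟ u
  ... | yes _ = cong (_+ 2) (sym (listSum-allFin n _))
  ... | no  _ = cong (_+ 0) (sym (listSum-allFin n _))
  blockRow-degree (inj₂ k) = cong (_+ ∑[ l < 7 ] ind (newAdj k l))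
    (trans (sum-cong-≗ (λ y → ind-∧ ⌊ y ≟ u ⌋ (attachedToU k))) (∑-pointMass n u (ind (attachedToU k))))

  degree-extend : ∀ p → degree G₁ p ≡ blockDegree (splitAt n p)
  degree-extend p =
    trans (listSum-allFin (n + 7) _)
          (trans (∑-splitAt n 7 (λ t → ind (extAdj G u (splitAt n p) t))) (blockRow-degree (splitAt n p)))

  -- Stepwise irregularity transfers, given that u has degree 2 with both
  -- neighbours of degree 3 (so that u gets degree 4 in G₁).
  module _ (si : StepwiseIrregular G) (deg-u : degree G u ≡ 2)
           (deg-nbr : ∀ w → adj G u w ≡ true → degree G w ≡ 3) where

    -- An edge of G: unchanged away from u; at u it joins degrees 4 and 3.
    old-old : ∀ x y → adj G x y ≡ true → Stepwise (blockDegree (inj₁ x)) (blockDegree (inj₁ y))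
    old-old x y e with x ≟ u | y ≟ u
    ... | yes refl | yes refl = contradiction (trans (sym (irrefl G u)) e) λ ()
    ... | yes refl | no _ rewrite deg-u | deg-nbr y e                         = inj₁ refl
    ... | no _ | yes refl rewrite deg-u | deg-nbr x (trans (adj-sym G u x) e) = inj₂ refl
    ... | no _ | no _ rewrite +-identityʳ (degree G x) | +-identityʳ (degree G y) = si x y e

    -- u (degree 4) against its gadget neighbours a and e (degree 3).
    old-new : ∀ x k → ⌊ x ≟ u ⌋ ∧ attachedToU k ≡ true → Stepwise (blockDegree (inj₁ x)) (gadgetDegree k)
    old-new x k e with x ≟ u
    old-new x k e | yes refl rewrite deg-u | attached-degree k e = inj₁ refl
    old-new x k () | no _

    blocks-stepwise : ∀ s t → extAdj G u s t ≡ true → Stepwise (blockDegree s) (blockDegree t)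
    blocks-stepwise (inj₁ x) (inj₁ y) e = old-old x y e
    blocks-stepwise (inj₁ x) (inj₂ k) e = old-new x k e
    blocks-stepwise (inj₂ k) (inj₁ x) e = swap (old-new x k e)
    blocks-stepwise (inj₂ k) (inj₂ l) e = gadget-stepwise k l e

    extend-stepwise : StepwiseIrregular G₁
    extend-stepwise p q e rewrite degree-extend p | degree-extend q =
      blocks-stepwise (splitAt n p) (splitAt n q) e

  old-edge : ∀ {x y} → adj G x y ≡ true → adj G₁ (x ↑ˡ 7) (y ↑ˡ 7) ≡ true
  old-edge {x} {y} e rewrite splitAt-↑ˡ n x 7 | splitAt-↑ˡ n y 7 = e

  gadget-edge : ∀ k l → newAdj k l ≡ true → adj G₁ (n ↑ʳ k) (n ↑ʳ l) ≡ true
  gadget-edge k l e rewrite splitAt-↑ʳ n 7 k | splitAt-↑ʳ n 7 l = e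

  attaching-edge : ∀ k → attachedToU k ≡ true → adj G₁ (n ↑ʳ k) (u ↑ˡ 7) ≡ true
  attaching-edge k e rewrite splitAt-↑ʳ n 7 k | splitAt-↑ˡ n u 7 with u ≟ u
  ... | yes _  = e
  ... | no u≢u = contradiction refl u≢u

  lift-walk : ∀ {x y} → Reach G x y → Reach G₁ (x ↑ˡ 7) (y ↑ˡ 7)
  lift-walk here       = here
  lift-walk (step e r) = step (old-edge e) (lift-walk r)

  a-reaches-u : Reach G₁ (n ↑ʳ 0F) (u ↑ˡ 7)
  a-reaches-u = step (attaching-edge 0F refl) here

  e-reaches-u : Reach G₁ (n ↑ʳ 4F) (u ↑ˡ 7)
  e-reaches-u = step (attaching-edge 4F refl) here

  gadget-reaches-u : ∀ k → Reach G₁ (n ↑ʳ k) (u ↑ˡ 7)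
  gadget-reaches-u 0F = a-reaches-u
  gadget-reaches-u 1F = step (gadget-edge 1F 0F refl) a-reaches-u
  gadget-reaches-u 2F = step (gadget-edge 2F 1F refl) (step (gadget-edge 1F 0F refl) a-reaches-u)
  gadget-reaches-u 3F = step (gadget-edge 3F 0F refl) a-reaches-u
  gadget-reaches-u 4F = e-reaches-u
  gadget-reaches-u 5F = step (gadget-edge 5F 4F refl) e-reaches-u
  gadget-reaches-u 6F = step (gadget-edge 6F 5F refl) (step (gadget-edge 5F 4F refl) e-reaches-u)

  reaches-u : Connected G → ∀ p → Reach G₁ p (u ↑ˡ 7)
  reaches-u conn p with splitAt n p in eq
  ... | inj₁ x = subst (λ q → Reach G₁ q (u ↑ˡ 7)) (splitAt⁻¹-↑ˡ eq) (lift-walk (conn x u))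
  ... | inj₂ k = subst (λ q → Reach G₁ q (u ↑ˡ 7)) (splitAt⁻¹-↑ʳ eq) (gadget-reaches-u k)

  extend-connected : Connected G → Connected G₁
  extend-connected conn = connected-via-hub (u ↑ˡ 7) (reaches-u conn)

  lowerEdge-old-old : ∀ x y → lowerEdge G₁ (x ↑ˡ 7) (y ↑ˡ 7) ≡ lowerEdge G x y
  lowerEdge-old-old x y rewrite toℕ-↑ˡ x 7 | toℕ-↑ˡ y 7 | splitAt-↑ˡ n x 7 | splitAt-↑ˡ n y 7 = refl

  lowerEdge-old-new : ∀ x k → lowerEdge G₁ (x ↑ˡ 7) (n ↑ʳ k) ≡ ind (⌊ x ≟ u ⌋ ∧ attachedToU k)
  lowerEdge-old-new x k rewrite toℕ-↑ˡ x 7 | toℕ-↑ʳ n k | <ᵇ-first-second (toℕ x) n (toℕ k) (toℕ<n x)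
                              | splitAt-↑ˡ n x 7 | splitAt-↑ʳ n 7 k = refl

  lowerEdge-new-old : ∀ k y → lowerEdge G₁ (n ↑ʳ k) (y ↑ˡ 7) ≡ 0
  lowerEdge-new-old k y rewrite toℕ-↑ˡ y 7 | toℕ-↑ʳ n k | <ᵇ-second-first n (toℕ k) (toℕ y) (toℕ<n y) = refl

  lowerEdge-new-new : ∀ k l → lowerEdge G₁ (n ↑ʳ k) (n ↑ʳ l) ≡ ind ((toℕ k <ᵇ toℕ l) ∧ newAdj k l)
  lowerEdge-new-new k l rewrite toℕ-↑ʳ n k | toℕ-↑ʳ n l | <ᵇ-shift n (toℕ k) (toℕ l)
                              | splitAt-↑ʳ n 7 k | splitAt-↑ʳ n 7 l = refl

  row-old : ∀ x → ∑[ q < n + 7 ] lowerEdge G₁ (x ↑ˡ 7) q ≡ ∑[ y < n ] lowerEdge G x y + bonus x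
  row-old x = trans (∑-++ n 7 _)
    (cong₂ _+_ (sum-cong-≗ (lowerEdge-old-old x))
               (trans (sum-cong-≗ (lowerEdge-old-new x)) (attachments ⌊ x ≟ u ⌋)))
    where
      attachments : ∀ b → ∑[ k < 7 ] ind (b ∧ attachedToU k) ≡ (if b then 2 else 0)
      attachments true  = refl
      attachments false = refl

  row-new : ∀ k → ∑[ q < n + 7 ] lowerEdge G₁ (n ↑ʳ k) q ≡ ∑[ l < 7 ] ind ((toℕ k <ᵇ toℕ l) ∧ newAdj k l)
  row-new k = trans (∑-++ n 7 _)
    (cong₂ _+_ (trans (sum-cong-≗ (lowerEdge-new-old k)) (sum-replicate-zero n))
               (sum-cong-≗ (lowerEdge-new-new k)))

  -- Two edges at u plus six gadget edges.
  numEdges-extend : numEdges G₁ ≡ numEdges G + 8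
  numEdges-extend = begin
    numEdges G₁
      ≡⟨ numEdges-∑ G₁ ⟩
    ∑[ p < n + 7 ] ∑[ q < n + 7 ] lowerEdge G₁ p q
      ≡⟨ ∑-++ n 7 _ ⟩
    ∑[ x < n ] ∑[ q < n + 7 ] lowerEdge G₁ (x ↑ˡ 7) q + ∑[ k < 7 ] ∑[ q < n + 7 ] lowerEdge G₁ (n ↑ʳ k) q
      ≡⟨ cong₂ _+_ (sum-cong-≗ row-old) (sum-cong-≗ row-new) ⟩
    ∑[ x < n ] (∑[ y < n ] lowerEdge G x y + bonus x) + 6
      ≡⟨ cong (_+ 6) (∑-distrib-+ (λ x → ∑[ y < n ] lowerEdge G x y) bonus) ⟩
    ∑[ x < n ] ∑[ y < n ] lowerEdge G x y + ∑[ x < n ] bonus x + 6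
      ≡⟨ cong (_+ 6) (cong₂ _+_ (sym (numEdges-∑ G)) (∑-pointMass n u 2)) ⟩
    numEdges G + 2 + 6
      ≡⟨ +-assoc (numEdges G) 2 6 ⟩
    numEdges G + 8  ∎
    where open ≡-Reasoning

  -- m grows by 8 and the number of vertices by 7.
  cyclomatic-extend : cyclomatic G₁ ≡ cyclomatic G ℤ.+ ℤ.+ 1
  cyclomatic-extend = begin
    ℤ.+ numEdges G₁ ℤ.- ℤ.+ (n + 7) ℤ.+ ℤ.+ 1
      ≡⟨ cong₂ (λ m v → m ℤ.- v ℤ.+ ℤ.+ 1) (trans (cong ℤ.+_ numEdges-extend) (pos-+ (numEdges G) 8)) (pos-+ n 7) ⟩
    (ℤ.+ numEdges G ℤ.+ ℤ.+ 8) ℤ.- (ℤ.+ n ℤ.+ ℤ.+ 7) ℤ.+ ℤ.+ 1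
      ≡⟨ shift (ℤ.+ numEdges G) (ℤ.+ n) ⟩
    ℤ.+ numEdges G ℤ.- ℤ.+ n ℤ.+ ℤ.+ 1 ℤ.+ ℤ.+ 1  ∎
    where
      open ≡-Reasoning
      shift : ∀ m v → (m ℤ.+ ℤ.+ 8) ℤ.- (v ℤ.+ ℤ.+ 7) ℤ.+ ℤ.+ 1 ≡ m ℤ.- v ℤ.+ ℤ.+ 1 ℤ.+ ℤ.+ 1
      shift = solve-∀

open import Data.Integer using (_+_; +_)
open import Data.Bool using (true)
open import Data.Product using (_×_; _,_)
open import Relation.Binary.PropositionalEquality using (_≡_)

mainTheorem7 : ∀ {n : ℕ} (G₀ : Graph n) (u : Fin n) →
    StepwiseIrregular G₀ →
    degree G₀ u ≡ 2 →
    (∀ w → adj G₀ u w ≡ true → degree G₀ w ≡ 3) →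
    StepwiseIrregular (extend G₀ u)
    × (Connected G₀ → Connected (extend G₀ u)
         × cyclomatic (extend G₀ u) ≡ cyclomatic G₀ + + 1)
mainTheorem7 G₀ u si deg-u deg-nbr =
  extend-stepwise si deg-u deg-nbr , λ conn → extend-connected conn , cyclomatic-extend
  where open Extension G₀ u
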